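{- Let $U$ be an ultrafilter on $\omega\times\omega$ such that $\mathrm{fin}\otimes\mathrm{fin}\subseteq U^*$, $U$ has the $\mathrm{fin}\otimes\mathrm{fin}$-pseudo intersection property, and $U$ is $2$-rapid. Then $U\cdot U\equiv_T U$.
   Context: $\mathrm{fin}\otimes\mathrm{fin}$ is the ideal on $\omega\times\omega$ of all $A$ with $\{n:\{m:(n,m)\in A\}\text{ infinite}\}$ finite. $U^*=P(\omega\times\omega)\setminus U$. For an ideal $I\subseteq U^*$, $U$ has the $I$-pseudo intersection property if for every $\langle A_n\rangle_{n<\omega}\subseteq U$ there is $A\in U$ with $A\setminus A_n\in I$ for all $n$. An ultrafilter $W$ on $\omega$ is rapid if for every increasing $f:\omega\to\omega$ there is $X\in W$ with $|X\cap f(n)|\le n$ for all $n$; $U$ is $2$-rapid if $\pi_*(U)=\{X\subseteq\omega:\pi^{ -1}X\in U\}$ is rapid, where $\pi$ is projection to the first coordinate. $U$ is ordered by $\supseteq$; $U\cdot U$ is the filter with $A\in U\cdot U$ iff $\{x:\{y:(x,y)\in A\}\in U\}\in U$. $P\le_TQ$ means there is $f:Q\to P$ mapping cofinal subsets to cofinal subsets; $\equiv_T$ is two-way $\le_T$. -}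

module Defs where

open import Level using (0ℓ)
open import Data.Nat using (ℕ; _≤_; _<_)
open import Data.Product using (Σ; ∃; _×_; _,_; proj₁; proj₂)
open import Data.Sum using (_⊎_)
open import Data.List using (List; length)
open import Data.List.Membership.Propositional using (_∈_)
open import Data.Empty using (⊥)
open import Relation.Nullary using (¬_)
open import Relation.Unary using (Pred; _⊆_; ∁; _∩_; ∅; U)
  renaming (_∈_ to _∈ₚ_)

Subset : Set → Set₁
Subset X = Pred X 0ℓ

Family : Set → Set₁
Family X = Pred (Subset X) 0ℓ

record IsUltrafilter {X : Set} (F : Family X) : Set₁ where
  field
    full     : U ∈ₚ F
    proper   : ¬ (∅ ∈ₚ F)
    upward   : ∀ {A B : Subset X} → A ∈ₚ F → A ⊆ B → B ∈ₚ F
    inter    : ∀ {A B : Subset X} → A ∈ₚ F → B ∈ₚ F → (A ∩ B) ∈ₚ F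
    ultra    : ∀ (A : Subset X) → A ∈ₚ F ⊎ ∁ A ∈ₚ F

_∖_ : {X : Set} → Subset X → Subset X → Subset X
A ∖ B = A ∩ ∁ B

Infinite : Subset ℕ → Set
Infinite X = ∀ n → ∃ λ m → n ≤ m × m ∈ₚ X

Finite : Subset ℕ → Set
Finite X = ∃ λ N → ∀ m → m ∈ₚ X → m < N

Row : Subset (ℕ × ℕ) → ℕ → Subset ℕ
Row A n m = (n , m) ∈ₚ A

FinFin : Family (ℕ × ℕ)
FinFin A = Finite (λ n → Infinite (Row A n))

-- I ⊆ U* (U* = P(ω×ω) \ U).
_⊆Dual_ : {X : Set} → Family X → Family X → Set₁
I ⊆Dual F = ∀ A → A ∈ₚ I → ¬ (A ∈ₚ F)

PseudoIntersectionProperty : {X : Set} → Family X → Family X → Set₁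
PseudoIntersectionProperty I F =
  (As : ℕ → Subset _) → (∀ n → As n ∈ₚ F) →
  Σ (Subset _) λ A → A ∈ₚ F × (∀ n → (A ∖ As n) ∈ₚ I)

-- |X ∩ k| ≤ n : X ∩ {0,…,k-1} has at most n elements.
AtMostBelow : ℕ → Subset ℕ → ℕ → Set
AtMostBelow n X k =
  ∃ λ (xs : List ℕ) → length xs ≤ n × (∀ m → m < k → m ∈ₚ X → m ∈ xs)

StrictlyIncreasing : (ℕ → ℕ) → Set
StrictlyIncreasing f = ∀ {m n} → m < n → f m < f n

Rapid : Family ℕ → Set₁
Rapid W = (f : ℕ → ℕ) → StrictlyIncreasing f →
  Σ (Subset ℕ) λ X → X ∈ₚ W × (∀ n → AtMostBelow n X (f n))

pushπ : Family (ℕ × ℕ) → Family ℕ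
pushπ F X = (λ p → proj₁ p ∈ₚ X) ∈ₚ F

TwoRapid : Family (ℕ × ℕ) → Set₁
TwoRapid F = Rapid (pushπ F)

_·_ : {X : Set} → Family X → Family X → Family (X × X)
(F · G) A = (λ x → (λ y → (x , y) ∈ₚ A) ∈ₚ G) ∈ₚ F

Elt : {X : Set} → Family X → Set₁
Elt F = Σ (Subset _) λ A → A ∈ₚ F

Cofinal : {X : Set} (F : Family X) → Pred (Elt F) 0ℓ → Set₁
Cofinal F C = ∀ (a : Elt F) → ∃ λ (c : Elt F) → c ∈ₚ C × proj₁ c ⊆ proj₁ a

ImageCofinal : {X Y : Set} (F : Family X) (G : Family Y) →
  (Elt G → Elt F) → Pred (Elt G) 0ℓ → Set₁
ImageCofinal F G f C =
  ∀ (a : Elt F) → ∃ λ (c : Elt G) → c ∈ₚ C × proj₁ (f c) ⊆ proj₁ a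

_≤T_ : {X Y : Set} → Family X → Family Y → Set₁
P ≤T Q = Σ (Elt Q → Elt P) λ f →
  (C : Pred (Elt Q) 0ℓ) → Cofinal Q C → ImageCofinal P Q f C

_≡T_ : {X Y : Set} → Family X → Family Y → Set₁
P ≡T Q = P ≤T Q × Q ≤T P

{-# OPTIONS --safe #-}
-- For 𝒰 ≤T 𝒰 · 𝒰 send D to the set of x whose section D_x is in 𝒰. For the converse
-- send A to the pairs (x, y) of A × A such that A meets more than |x| = x₁ + x₂ rows
-- below the row of y; this is in 𝒰 · 𝒰 because A meets unboundedly many rows. Given
-- D ∈ 𝒰 · 𝒰, the pseudo intersection property yields A′ ∈ 𝒰 such that, from some row N(k)
-- on, A′ lies up to finite parts of rows in the intersection of the sections D_x with
-- x₁, x₂ < k. Thinning A′ so that its row n lies in that intersection for the largest k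
-- with N(1), …, N(k) ≤ n keeps it in 𝒰. Finally 2-rapidity yields X ∈ π_*(𝒰) with
-- at most |x| points below f(|x|), where f majorises N; so if A ⊆ π⁻¹ X and A meets more
-- than |x| rows below the row of y, that row is beyond f(|x|), which forces y ∈ D_x.
module Submission where

open import Defs
open import Level using (0ℓ)
open import Data.Nat using (ℕ; zero; suc; _+_; _≤_; _<_; _≤?_; _<?_; _≟_; z≤n; s≤s)
open import Data.Nat.Properties
open import Data.Product using (∃; _×_; _,_; proj₁; proj₂)
open import Data.Sum using (_⊎_; inj₁; inj₂)
open import Data.Empty using (⊥; ⊥-elim)
open import Data.List using ([]; _∷_; filter)
open import Data.List.Membership.Propositional.Properties using (∈-filter⁺)
open import Data.List.Properties using (filter-notAll)
import Data.List.Relation.Unary.Any as Any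
open import Relation.Nullary using (¬_; yes; no; ¬?)
open import Relation.Nullary.Negation using (¬¬-map)
open import Relation.Binary.PropositionalEquality using (_≡_; refl; sym)
open import Relation.Unary using (Pred; Decidable; _⊆_; ∁) renaming (_∈_ to _∈ₚ_)

monotone-cofinal⇒≤T : {X Y : Set} (F : Family X) (G : Family Y) (f : Elt G → Elt F) →
  (∀ a b → proj₁ a ⊆ proj₁ b → proj₁ (f a) ⊆ proj₁ (f b)) →
  (∀ (a : Elt F) → ∃ λ (b : Elt G) → proj₁ (f b) ⊆ proj₁ a) → F ≤T G
monotone-cofinal⇒≤T F G f mono cofinal = f , λ C C-cofinal a →
  let (b , fb⊆a) = cofinal a
      (c , c∈C , c⊆b) = C-cofinal b
  in c , c∈C , λ z → fb⊆a (mono c b c⊆b z)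

Infinite-⊆ : ∀ {X Y : Subset ℕ} → X ⊆ Y → Infinite X → Infinite Y
Infinite-⊆ X⊆Y X-inf t = let (m , t≤m , m∈X) = X-inf t in m , t≤m , X⊆Y m∈X

¬¬Unbounded : Subset ℕ → Set
¬¬Unbounded X = ∀ t → ¬ ¬ (∃ λ m → t ≤ m × m ∈ₚ X)

¬¬Unbounded-above : ∀ {X} p → ¬¬Unbounded X → ¬¬Unbounded (λ m → p < m × m ∈ₚ X)
¬¬Unbounded-above p X-unb t ¬above = X-unb (suc p + t) λ (m , sp+t≤m , m∈X) →
  ¬above (m , ≤-trans (m≤n+m t (suc p)) sp+t≤m , ≤-trans (m≤m+n (suc p) t) sp+t≤m , m∈X)

AtMostBelow-≤ : ∀ {n X b c} → c ≤ b → AtMostBelow n X b → AtMostBelow n X c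
AtMostBelow-≤ c≤b (xs , len , cover) = xs , len , λ m m<c → cover m (<-≤-trans m<c c≤b)

AtMostBelow-⊆ : ∀ {n X Y b} → X ⊆ Y → AtMostBelow n Y b → AtMostBelow n X b
AtMostBelow-⊆ X⊆Y (xs , len , cover) = xs , len , λ m m<b m∈X → cover m m<b (X⊆Y m∈X)

¬AtMostBelow-zero : ∀ {X b m} → m < b → m ∈ₚ X → ¬ AtMostBelow 0 X b
¬AtMostBelow-zero m<b m∈X ([] , _ , cover) with cover _ m<b m∈X
... | ()
¬AtMostBelow-zero _ _ (_ ∷ _ , () , _)

AtMostBelow-remove : ∀ {k X b p} → p < b → p ∈ₚ X → AtMostBelow (suc k) X b →
  AtMostBelow k (λ m → p < m × m ∈ₚ X) b
AtMostBelow-remove {p = p} p<b p∈X (xs , len , cover) =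
  filter ≢p? xs ,
  m<1+n⇒m≤n (<-≤-trans (filter-notAll ≢p? xs (Any.map (λ p≡m m≢p → m≢p (sym p≡m)) p∈xs)) len) ,
  λ m m<b (p<m , m∈X) → ∈-filter⁺ ≢p? (cover m m<b m∈X) (λ m≡p → <-irrefl (sym m≡p) p<m)
  where
  ≢p? = λ m → ¬? (m ≟ p)
  p∈xs = cover p p<b p∈X

¬¬Unbounded⇒¬¬exceeds : ∀ {X} → ¬¬Unbounded X → ∀ k → ¬ ¬ (∃ λ b → ¬ AtMostBelow k X b)
¬¬Unbounded⇒¬¬exceeds X-unb zero ¬exceeds = X-unb 0 λ (m , _ , m∈X) →
  ¬exceeds (suc m , ¬AtMostBelow-zero ≤-refl m∈X)
¬¬Unbounded⇒¬¬exceeds X-unb (suc k) ¬exceeds = X-unb 0 λ (p , _ , p∈X) →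
  ¬¬Unbounded⇒¬¬exceeds (¬¬Unbounded-above p X-unb) k λ (b , ¬few) →
    ¬exceeds (b + suc p , λ few → ¬few (AtMostBelow-≤ (m≤m+n b (suc p))
      (AtMostBelow-remove (m≤n+m (suc p) b) p∈X few)))

longestPrefix : {P : Pred ℕ 0ℓ} → Decidable P → ℕ → ℕ
longestPrefix P? zero = zero
longestPrefix P? (suc n) with P? zero
... | yes _ = suc (longestPrefix (λ j → P? (suc j)) n)
... | no _ = zero

longestPrefix-holds : ∀ {P} (P? : Decidable P) n j → j < longestPrefix P? n → j ∈ₚ P
longestPrefix-holds P? (suc n) j j< with P? zero
longestPrefix-holds P? (suc n) zero _ | yes P0 = P0
longestPrefix-holds P? (suc n) (suc j) (s≤s j<) | yes _ =
  longestPrefix-holds (λ j → P? (suc j)) n j j<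

longestPrefix-maximal : ∀ {P} (P? : Decidable P) n K → K ≤ n → (∀ j → j < K → j ∈ₚ P) →
  K ≤ longestPrefix P? n
longestPrefix-maximal P? n zero _ _ = z≤n
longestPrefix-maximal P? (suc n) (suc K) (s≤s K≤n) P-below with P? zero
... | yes _ = s≤s (longestPrefix-maximal (λ j → P? (suc j)) n K K≤n
                     λ j j<K → P-below (suc j) (s≤s j<K))
... | no ¬P0 = ⊥-elim (¬P0 (P-below zero (s≤s z≤n)))

strictlyIncreasing⇒≥ : ∀ f → StrictlyIncreasing f → ∀ k → k ≤ f k
strictlyIncreasing⇒≥ f f-inc zero = z≤n
strictlyIncreasing⇒≥ f f-inc (suc k) = ≤-<-trans (strictlyIncreasing⇒≥ f f-inc k) (f-inc (n<1+n k))

majorant : (ℕ → ℕ) → ℕ → ℕ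
majorant N zero = N zero
majorant N (suc k) = suc (majorant N k + N (suc k))

majorant-< : ∀ N k → majorant N k < majorant N (suc k)
majorant-< N k = s≤s (m≤m+n _ _)

majorant-strictlyIncreasing : ∀ N → StrictlyIncreasing (majorant N)
majorant-strictlyIncreasing N {n = suc n} m<1+n with m<1+n⇒m<n∨m≡n m<1+n
... | inj₁ m<n = <-trans (majorant-strictlyIncreasing N m<n) (majorant-< N n)
... | inj₂ refl = majorant-< N n

majorant-dominates : ∀ N {j k} → j ≤ k → N j ≤ majorant N k
majorant-dominates N {k = zero} z≤n = ≤-refl
majorant-dominates N {k = suc k} j≤1+k with m≤n⇒m<n∨m≡n j≤1+k
... | inj₁ j<1+k = ≤-trans (majorant-dominates N (m<1+n⇒m≤n j<1+k)) (<⇒≤ (majorant-< N k))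
... | inj₂ refl = ≤-trans (m≤n+m (N (suc k)) (majorant N k)) (n≤1+n _)

module UltrafilterProperties {X : Set} {F : Family X} (F-ultra : IsUltrafilter F) where
  open IsUltrafilter F-ultra

  ∈∧∁∈⇒⊥ : ∀ {S} → S ∈ₚ F → ∁ S ∈ₚ F → ⊥
  ∈∧∁∈⇒⊥ S∈F ∁S∈F = proper (upward (inter S∈F ∁S∈F) λ (x∈S , x∉S) → x∉S x∈S)

  ¬∁∈⇒∈ : ∀ S → ¬ (∁ S ∈ₚ F) → S ∈ₚ F
  ¬∁∈⇒∈ S ∁S∉F with ultra S
  ... | inj₁ S∈F = S∈F
  ... | inj₂ ∁S∈F = ⊥-elim (∁S∉F ∁S∈F)

  ¬¬∈⇒∈ : ∀ {S} → ¬ ¬ (S ∈ₚ F) → S ∈ₚ F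
  ¬¬∈⇒∈ {S} ¬¬S∈F = ¬∁∈⇒∈ S λ ∁S∈F → ¬¬S∈F λ S∈F → ∈∧∁∈⇒⊥ S∈F ∁S∈F

  ∈⇒¬¬nonempty : ∀ {S} → S ∈ₚ F → ¬ ¬ (∃ λ x → x ∈ₚ S)
  ∈⇒¬¬nonempty S∈F S-empty = proper (upward S∈F λ x∈S → S-empty (_ , x∈S))

  ∖∈-dual : ∀ {I} → I ⊆Dual F → ∀ {A B} → A ∈ₚ F → (A ∖ B) ∈ₚ I → B ∈ₚ F
  ∖∈-dual I-dual {A} {B} A∈F A∖B∈I = ¬∁∈⇒∈ B λ ∁B∈F → I-dual (A ∖ B) A∖B∈I (inter A∈F ∁B∈F)

  ⋂<-∈ : (S : ℕ → Subset X) → (∀ i → S i ∈ₚ F) → ∀ k → (λ x → ∀ i → i < k → x ∈ₚ S i) ∈ₚ F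
  ⋂<-∈ S S∈F zero = upward full λ _ _ ()
  ⋂<-∈ S S∈F (suc k) = upward (inter (⋂<-∈ S S∈F k) (S∈F k)) λ (below , x∈Sk) i i<1+k →
    case-< below x∈Sk i (m<1+n⇒m<n∨m≡n i<1+k)
    where
    case-< : ∀ {x} → (∀ i → i < k → x ∈ₚ S i) → x ∈ₚ S k → ∀ i → i < k ⊎ i ≡ k → x ∈ₚ S i
    case-< below _ i (inj₁ i<k) = below i i<k
    case-< _ x∈Sk _ (inj₂ refl) = x∈Sk

  conditional-∈ : ∀ S → (λ x → S ∈ₚ F → x ∈ₚ S) ∈ₚ F
  conditional-∈ S with ultra S
  ... | inj₁ S∈F = upward S∈F λ x∈S _ → x∈S
  ... | inj₂ ∁S∈F = upward ∁S∈F λ _ S∈F → ⊥-elim (∈∧∁∈⇒⊥ S∈F ∁S∈F)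

  ≤T-square : F ≤T (F · F)
  ≤T-square = monotone-cofinal⇒≤T F (F · F) big-sections big-sections-⊆ big-sections-cofinal
    where
    -- the witness y lets big-sections-cofinal recover x ∈ B without excluded middle
    BigSections : Subset (X × X) → Subset X
    BigSections D x = (λ y → (x , y) ∈ₚ D) ∈ₚ F × ∃ λ y → (x , y) ∈ₚ D

    big-sections : Elt (F · F) → Elt F
    big-sections (D , D∈F²) = BigSections D , ¬∁∈⇒∈ _ λ ∁big∈F →
      proper (upward (inter D∈F²  ∁big∈F) λ (Dx∈F , ¬big) →
        ∈⇒¬¬nonempty Dx∈F λ (y , xy∈D) → ¬big (Dx∈F , y , xy∈D))

    big-sections-⊆ : ∀ D E → proj₁ D ⊆ proj₁ E → proj₁ (big-sections D) ⊆ proj₁ (big-sections E)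
    big-sections-⊆ _ _ D⊆E (Dx∈F , y , xy∈D) = upward Dx∈F D⊆E , y , D⊆E xy∈D

    big-sections-cofinal : ∀ (B : Elt F) → ∃ λ (D : Elt (F · F)) → proj₁ (big-sections D) ⊆ proj₁ B
    big-sections-cofinal (B , B∈F) =
      ((λ (x , _) → x ∈ₚ B) , upward B∈F λ x∈B → upward full λ _ → x∈B) ,
      λ (_ , _ , x∈B) → x∈B

π[_] : Subset (ℕ × ℕ) → Subset ℕ
π[ A ] m = ∃ λ n → (m , n) ∈ₚ A

weight : ℕ × ℕ → ℕ
weight (a , b) = a + b

FarPairs : Subset (ℕ × ℕ) → Subset ((ℕ × ℕ) × (ℕ × ℕ))
FarPairs A (x , y) = x ∈ₚ A × y ∈ₚ A × ¬ AtMostBelow (weight x) π[ A ] (proj₁ y)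

FarPairs-⊆ : ∀ {A B} → A ⊆ B → FarPairs A ⊆ FarPairs B
FarPairs-⊆ A⊆B (x∈A , y∈A , many) =
  A⊆B x∈A , A⊆B y∈A , λ few → many (AtMostBelow-⊆ (λ (n , mn∈A) → n , A⊆B mn∈A) few)

module FinFinDual (𝒰 : Family (ℕ × ℕ)) (𝒰-ultra : IsUltrafilter 𝒰)
                  (finfin-dual : FinFin ⊆Dual 𝒰) where
  open IsUltrafilter 𝒰-ultra
  open UltrafilterProperties 𝒰-ultra

  rows≥-∈ : ∀ b → (λ y → b ≤ proj₁ y) ∈ₚ 𝒰
  rows≥-∈ b = ∖∈-dual finfin-dual full
    (b , λ n row-inf → let (_ , _ , _ , b≰n) = row-inf 0 in ≰⇒> b≰n)

  π[]-¬¬Unbounded : ∀ {A} → A ∈ₚ 𝒰 → ¬¬Unbounded π[ A ]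
  π[]-¬¬Unbounded {A} A∈𝒰 t ¬above = finfin-dual A
    (t , λ n row-inf → ≰⇒> λ t≤n → let (m , _ , nm∈A) = row-inf 0 in ¬above (n , t≤n , m , nm∈A))
    A∈𝒰

  FarPairs-∈ : ∀ {A} → A ∈ₚ 𝒰 → FarPairs A ∈ₚ (𝒰 · 𝒰)
  FarPairs-∈ {A} A∈𝒰 = upward A∈𝒰 λ {x} x∈A →
    ¬¬∈⇒∈ (¬¬-map (far-rows x∈A) (¬¬Unbounded⇒¬¬exceeds (π[]-¬¬Unbounded A∈𝒰) (weight x)))
    where
    far-rows : ∀ {x} → x ∈ₚ A → (∃ λ b → ¬ AtMostBelow (weight x) π[ A ] b) →
      (λ y → FarPairs A (x , y)) ∈ₚ 𝒰
    far-rows x∈A (b , many) = upward (inter A∈𝒰 (rows≥-∈ b)) λ (y∈A , b≤y) →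
      x∈A , y∈A , λ few → many (AtMostBelow-≤ b≤y few)

  module FarPairsCofinal (pip : PseudoIntersectionProperty FinFin 𝒰) (rapid : TwoRapid 𝒰)
                         (D : Subset ((ℕ × ℕ) × (ℕ × ℕ))) (D∈𝒰² : D ∈ₚ (𝒰 · 𝒰)) where
    section : ℕ × ℕ → Subset (ℕ × ℕ)
    section x y = (x , y) ∈ₚ D

    Square : ℕ → Subset (ℕ × ℕ)
    Square k y = ∀ a → a < k → ∀ b → b < k → section (a , b) ∈ₚ 𝒰 → y ∈ₚ section (a , b)

    Square-∈ : ∀ k → Square k ∈ₚ 𝒰
    Square-∈ k = ⋂<-∈ _ (λ a → ⋂<-∈ _ (λ b → conditional-∈ (section (a , b))) k) k

    Pseudo : Subset (ℕ × ℕ)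
    Pseudo = proj₁ (pip Square Square-∈)

    Pseudo-∈ : Pseudo ∈ₚ 𝒰
    Pseudo-∈ = proj₁ (proj₂ (pip Square Square-∈))

    bound : ℕ → ℕ
    bound k = proj₁ (proj₂ (proj₂ (pip Square Square-∈)) k)

    bound-spec : ∀ k n → Infinite (Row (Pseudo ∖ Square k) n) → n < bound k
    bound-spec k = proj₂ (proj₂ (proj₂ (pip Square Square-∈)) k)

    ψ : ℕ → ℕ
    ψ n = longestPrefix (λ j → bound (suc j) ≤? n) n

    row-Pseudo∖Square-ψ : ∀ n → ¬ Infinite (Row (Pseudo ∖ Square (ψ n)) n)
    row-Pseudo∖Square-ψ n with ψ n | longestPrefix-holds (λ j → bound (suc j) ≤? n) n
    ... | zero | _ = λ row-inf → let (_ , _ , _ , ¬square) = row-inf 0 in ¬square λ _ ()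
    ... | suc j | bounds≤n = λ row-inf → <⇒≱ (bound-spec (suc j) n row-inf) (bounds≤n j (n<1+n j))

    Thin : Subset (ℕ × ℕ)
    Thin y = y ∈ₚ Pseudo × y ∈ₚ Square (ψ (proj₁ y))

    Thin-∈ : Thin ∈ₚ 𝒰
    Thin-∈ = ∖∈-dual finfin-dual Pseudo-∈ (0 , λ n row-inf → ⊥-elim (row-Pseudo∖Square-ψ n
      (Infinite-⊆ (λ (y∈Pseudo , ¬thin) → y∈Pseudo , λ square → ¬thin (y∈Pseudo , square)) row-inf)))

    f : ℕ → ℕ
    f = majorant (λ j → bound (suc j))

    f-strictlyIncreasing : StrictlyIncreasing f
    f-strictlyIncreasing = majorant-strictlyIncreasing _

    ψ-large : ∀ k n → f k < n → k < ψ n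
    ψ-large k n fk<n = longestPrefix-maximal _ n (suc k)
      (≤-<-trans (strictlyIncreasing⇒≥ f f-strictlyIncreasing k) fk<n)
      λ j j<1+k → <⇒≤ (≤-<-trans (majorant-dominates _ (m<1+n⇒m≤n j<1+k)) fk<n)

    Sparse : Subset ℕ
    Sparse = proj₁ (rapid f f-strictlyIncreasing)

    Witness : Subset (ℕ × ℕ)
    Witness y = section y ∈ₚ 𝒰 × y ∈ₚ Thin × proj₁ y ∈ₚ Sparse

    Witness-∈ : Witness ∈ₚ 𝒰
    Witness-∈ = inter D∈𝒰² (inter Thin-∈ (proj₁ (proj₂ (rapid f f-strictlyIncreasing))))

    FarPairs-Witness⊆D : FarPairs Witness ⊆ D
    FarPairs-Witness⊆D {(a , b) , y} (x∈W , (_ , (_ , square) , _) , many) with f (a + b) <? proj₁ y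
    ... | yes f[a+b]<y = square a (≤-<-trans (m≤m+n a b) a+b<ψ) b (≤-<-trans (m≤n+m b a) a+b<ψ)
                                  (proj₁ x∈W)
      where a+b<ψ = ψ-large (a + b) (proj₁ y) f[a+b]<y
    ... | no f[a+b]≮y = ⊥-elim (many (AtMostBelow-⊆ (λ (_ , _ , _ , m∈Sparse) → m∈Sparse)
            (AtMostBelow-≤ (≮⇒≥ f[a+b]≮y) (proj₂ (proj₂ (rapid f f-strictlyIncreasing)) (a + b)))))

  FarPairs-cofinal : PseudoIntersectionProperty FinFin 𝒰 → TwoRapid 𝒰 →
    ∀ (D : Elt (𝒰 · 𝒰)) → ∃ λ (A : Elt 𝒰) → FarPairs (proj₁ A) ⊆ proj₁ D
  FarPairs-cofinal pip rapid (D , D∈𝒰²) = (Witness , Witness-∈) , FarPairs-Witness⊆D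
    where open FarPairsCofinal pip rapid D D∈𝒰²

  square≤T : PseudoIntersectionProperty FinFin 𝒰 → TwoRapid 𝒰 → (𝒰 · 𝒰) ≤T 𝒰
  square≤T pip rapid = monotone-cofinal⇒≤T (𝒰 · 𝒰) 𝒰 (λ (A , A∈𝒰) → FarPairs A , FarPairs-∈ A∈𝒰)
    (λ _ _ → FarPairs-⊆) (FarPairs-cofinal pip rapid)

corollary2p6 : (𝒰 : Family (ℕ × ℕ)) → IsUltrafilter 𝒰 → FinFin ⊆Dual 𝒰 →
    PseudoIntersectionProperty FinFin 𝒰 → TwoRapid 𝒰 → (𝒰 · 𝒰) ≡T 𝒰
corollary2p6 𝒰 𝒰-ultra finfin-dual pip rapid =
  FinFinDual.square≤T 𝒰 𝒰-ultra finfin-dual pip rapid , UltrafilterProperties.≤T-square 𝒰-ultra
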